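{- Let $k\ge2$ and let $(\sigma_1,\dots,\sigma_k)$ be an allowable sequence with $\sigma_1,\dots,\sigma_k\in\mathfrak{S}_n$. Then there exists a standard permuted composition tableau $\tau$ of shape $(k^n)$ such that $\mathrm{st}_i(\tau)=\sigma_i$ for all $1\le i\le k$.
   Context: For $\sigma,\gamma\in\mathfrak{S}_n$, the pair $(\sigma,\gamma)$ is allowable if (a) for all $1\le i<j\le n$, $\sigma(i)>\sigma(j)$ implies $\gamma(i)>\gamma(j)$, and (b) for all $1\le i<j<l\le n$ with $\sigma(i)<\sigma(j)<\sigma(l)$, it is not the case that $\gamma(j)<\gamma(l)<\gamma(i)$. A sequence $(\sigma_1,\dots,\sigma_k)$ is allowable if each consecutive pair $(\sigma_j,\sigma_{j+1})$ is allowable. A standard permuted composition tableau of shape $(k^n)$ is a filling $\tau$ of the $n\times k$ array ($n$ rows, each with $k$ cells) with the distinct integers $1,\dots,kn$ such that rows decrease from left to right and (triple condition) whenever $i<r$ and the cells $(i,j),(i,j+1),(r,j+1)$ have entries $a,b,c$, $a\ge c$ implies $b>c$. For $1\le j\le k$, $\mathrm{st}_j(\tau)\in\mathfrak{S}_n$ is the standardization of the $j$-th column read top to bottom, i.e. the unique $\pi\in\mathfrak{S}_n$ with $\pi(i)>\pi(r)$ iff the entry of row $i$ exceeds that of row $r$ in column $j$. -}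

module Defs where

open import Data.Nat using (ℕ; suc; _*_; _≤_; _≥_; _>_; _<_)
open import Data.Fin using (Fin; toℕ; inject₁) renaming (suc to fsuc; _<_ to _<ᶠ_; _>_ to _>ᶠ_)
open import Data.Fin.Permutation using (Permutation′; _⟨$⟩ʳ_)
open import Data.Product using (_×_; Σ; _,_)
open import Relation.Nullary using (¬_)
open import Relation.Binary.PropositionalEquality using (_≡_)
open import Function using (_⇔_)

-- A permutation of [n] = {1..n} is a bijection Fin n ↔ Fin n
-- (positions and values both shifted down by one; only order matters).

-- Condition (a) and (b) of allowability of the pair (σ , γ).
AllowablePair : ∀ {n} → Permutation′ n → Permutation′ n → Set
AllowablePair {n} σ γ =
  (∀ (i j : Fin n) → i <ᶠ j → (σ ⟨$⟩ʳ i) >ᶠ (σ ⟨$⟩ʳ j) → (γ ⟨$⟩ʳ i) >ᶠ (γ ⟨$⟩ʳ j))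
  × (∀ (i j l : Fin n) → i <ᶠ j → j <ᶠ l →
       (σ ⟨$⟩ʳ i) <ᶠ (σ ⟨$⟩ʳ j) → (σ ⟨$⟩ʳ j) <ᶠ (σ ⟨$⟩ʳ l) →
       ¬ (((γ ⟨$⟩ʳ j) <ᶠ (γ ⟨$⟩ʳ l)) × ((γ ⟨$⟩ʳ l) <ᶠ (γ ⟨$⟩ʳ i))))

-- A sequence (σ_1,…,σ_k), indexed by Fin k (σ_1 at index 0), is allowable
-- if each consecutive pair (σ_j , σ_{j+1}) is allowable.
AllowableSeq : ∀ {n k} → (Fin k → Permutation′ n) → Set
AllowableSeq {n} {suc k} σ = ∀ (j : Fin k) → AllowablePair (σ (inject₁ j)) (σ (fsuc j))
AllowableSeq {n} {0} σ = Data.Unit.⊤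
  where import Data.Unit

-- A filling of the n × k array (rows Fin n top to bottom, columns Fin k left to right).
Filling : ℕ → ℕ → Set
Filling n k = Fin n → Fin k → ℕ

record IsSPCT {n k : ℕ} (τ : Filling n k) : Set where
  field
    distinct : ∀ i j r l → τ i j ≡ τ r l → (i ≡ r) × (j ≡ l)
    -- entries lie in {1,…,kn} (with distinctness: exactly 1,…,kn)
    range    : ∀ i j → 1 ≤ τ i j × τ i j ≤ k * n
    rowsDec  : ∀ (i : Fin n) (j j' : Fin k) → j <ᶠ j' → τ i j > τ i j'
    triple   : ∀ (i r : Fin n) (j : Fin k) (j+1 : Fin k) → toℕ j+1 ≡ suc (toℕ j) →
               i <ᶠ r → τ i j ≥ τ r j+1 → τ i j+1 > τ r j+1

StEq : ∀ {n k} → Filling n k → Fin k → Permutation′ n → Set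
StEq {n} τ j π = ∀ (i r : Fin n) → ((π ⟨$⟩ʳ i) >ᶠ (π ⟨$⟩ʳ r)) ⇔ (τ i j > τ r j)

-- Build integer columns from right to left, column j realising the order σ_j: the entry of
-- row i in column j is put just above the largest entry of column j+1 over the rows r with
-- σ_j(r) ≤ σ_j(i) (attained at the peak of i), written in base n+1 with last digit
-- σ_j(i)+1 ∈ [1,n]; scaling column j by (n+1)^j then makes all kn entries distinct.
-- Rows decrease since i is among its own lower rows.  For the triple condition, if i < r
-- and the column-(j+1) entry of r is at most the column-j entry of i, it is at most the
-- column-(j+1) entry of the peak s of i, and allowability of (σ_j, σ_{j+1}) (condition (a)
-- when i ≤ s, (b) when s < i) forces it below the column-(j+1) entry of i.  Replacing every
-- entry by its rank among all kn entries gives the tableau.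
module Submission where

open import Defs using (AllowablePair; AllowableSeq; Filling; IsSPCT; StEq)
open import Data.Nat
open import Data.Nat.Properties
open import Data.Fin as Fin using (Fin; zero; suc; toℕ; inject₁; combine; remQuot)
import Data.Fin.Properties as Fin
open import Data.Fin.Permutation using (Permutation′; _⟨$⟩ʳ_)
open import Data.List using (List; filter; allFin)
open import Data.List.Extrema.Nat using (argmax; argmax-all; v≤f[argmax]⁺)
open import Data.List.Relation.Unary.All.Properties using (all-filter)
open import Data.List.Membership.Propositional using (lose)
open import Data.List.Membership.Propositional.Properties using (∈-filter⁺; ∈-allFin)
open import Data.Product using (Σ; ∃-syntax; _×_; _,_; uncurry)
open import Data.Sum using (inj₂)
open import Function using (_∘_; mk⇔; Injection)
open import Function.Properties.Inverse using (↔⇒↣)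
open import Relation.Nullary using (yes; no; contradiction)
open import Relation.Binary.PropositionalEquality
open import Relation.Binary.Definitions using (tri<; tri≈; tri>)

v≤m⇒b*v<b*m+d : ∀ b {d v m} → 0 < d → v ≤ m → b * v < b * m + d
v≤m⇒b*v<b*m+d b {m = m} 0<d v≤m = ≤-<-trans (*-monoʳ-≤ b v≤m) (m<m+n (b * m) 0<d)

b*v≤b*m+d⇒v≤m : ∀ b {d v m} → d < b → b * v ≤ b * m + d → v ≤ m
b*v≤b*m+d⇒v≤m b {d} {v} {m} d<b b*v≤b*m+d = ≮⇒≥ λ m<v → <⇒≱ (b*m+d<b*v m<v) b*v≤b*m+d
  where
  open ≤-Reasoning
  b*m+d<b*v : m < v → b * m + d < b * v
  b*m+d<b*v m<v = begin-strict
    b * m + d  <⟨ +-monoʳ-< (b * m) d<b ⟩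
    b * m + b  ≡⟨ +-comm (b * m) b ⟩
    b + b * m  ≡⟨ *-suc b m ⟨
    b * suc m  ≤⟨ *-monoʳ-≤ b m<v ⟩
    b * v      ∎

b*v≢b*m+d : ∀ b {d v m} → 0 < d → d < b → b * v ≢ b * m + d
b*v≢b*m+d b 0<d d<b eq =
  <⇒≢ (v≤m⇒b*v<b*m+d b 0<d (b*v≤b*m+d⇒v≤m b d<b (≤-reflexive eq))) eq

^-suc-* : ∀ b a c → b ^ suc a * c ≡ b ^ a * (b * c)
^-suc-* b a c = trans (cong (_* c) (*-comm b (b ^ a))) (*-assoc (b ^ a) b c)

^-*-multiple : ∀ b {a l} c → a < l → ∃[ v ] b ^ l * c ≡ b ^ a * (b * v)
^-*-multiple b {zero} {suc l} c _ =
  b ^ l * c , trans (*-assoc b (b ^ l) c) (sym (*-identityˡ _))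
^-*-multiple b {suc a} {suc l} c (s≤s a<l) with ^-*-multiple b c a<l
... | v , eq = v , (begin
  b * b ^ l * c        ≡⟨ *-assoc b (b ^ l) c ⟩
  b * (b ^ l * c)      ≡⟨ cong (b *_) eq ⟩
  b * (b ^ a * (b * v)) ≡⟨ *-assoc b (b ^ a) (b * v) ⟨
  b * b ^ a * (b * v)  ∎)
  where open ≡-Reasoning

countBelow : ∀ {m} → (Fin m → ℕ) → ℕ → ℕ
countBelow {zero}  f w = 0
countBelow {suc m} f w with f zero <? w
... | yes _ = suc (countBelow (f ∘ suc) w)
... | no  _ = countBelow (f ∘ suc) w

countBelow≤length : ∀ {m} (f : Fin m → ℕ) w → countBelow f w ≤ m
countBelow≤length {zero}  f w = z≤n
countBelow≤length {suc m} f w with f zero <? w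
... | yes _ = s≤s (countBelow≤length (f ∘ suc) w)
... | no  _ = m≤n⇒m≤1+n (countBelow≤length (f ∘ suc) w)

countBelow-mono : ∀ {m} (f : Fin m → ℕ) {w w′} → w ≤ w′ → countBelow f w ≤ countBelow f w′
countBelow-mono {zero}  f w≤w′ = z≤n
countBelow-mono {suc m} f {w} {w′} w≤w′ with f zero <? w | f zero <? w′
... | yes _  | yes _  = s≤s (countBelow-mono (f ∘ suc) w≤w′)
... | yes lt | no nlt = contradiction (<-≤-trans lt w≤w′) nlt
... | no _   | yes _  = m≤n⇒m≤1+n (countBelow-mono (f ∘ suc) w≤w′)
... | no _   | no _   = countBelow-mono (f ∘ suc) w≤w′

countBelow-mono-< : ∀ {m} (f : Fin m → ℕ) x {w w′} → w ≤ f x → f x < w′ →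
                    countBelow f w < countBelow f w′
countBelow-mono-< {suc m} f x {w} {w′} w≤fx fx<w′ with f zero <? w | f zero <? w′ | x
... | yes lt | no nlt | _     = contradiction (<-trans lt (≤-<-trans w≤fx fx<w′)) nlt
... | yes lt | yes _  | zero  = contradiction w≤fx (<⇒≱ lt)
... | no _   | yes _  | zero  = s≤s (countBelow-mono (f ∘ suc) (<⇒≤ (≤-<-trans w≤fx fx<w′)))
... | no _   | no nlt | zero  = contradiction fx<w′ nlt
... | yes _  | yes _  | suc x = s≤s (countBelow-mono-< (f ∘ suc) x w≤fx fx<w′)
... | no _   | yes _  | suc x = m<n⇒m<1+n (countBelow-mono-< (f ∘ suc) x w≤fx fx<w′)
... | no _   | no _   | suc x = countBelow-mono-< (f ∘ suc) x w≤fx fx<w′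

countBelow<length : ∀ {m} (f : Fin m → ℕ) x {w} → w ≤ f x → countBelow f w < m
countBelow<length f x w≤fx =
  <-≤-trans (countBelow-mono-< f x w≤fx (n<1+n _)) (countBelow≤length f _)

InjectiveFilling : ∀ {n k} → Filling n k → Set
InjectiveFilling W = ∀ i j r l → W i j ≡ W r l → (i ≡ r) × (j ≡ l)

module _ {n k : ℕ} (W : Filling n k) where

  private
    entries : Fin (n * k) → ℕ
    entries x = uncurry W (remQuot k x)

    entries-combine : ∀ i j → entries (combine i j) ≡ W i j
    entries-combine i j = cong (uncurry W) (Fin.remQuot-combine i j)

  standardise : Filling n k
  standardise i j = suc (countBelow entries (W i j))

  standardise-mono-≤ : ∀ i j r l → W i j ≤ W r l → standardise i j ≤ standardise r l
  standardise-mono-≤ _ _ _ _ le = s≤s (countBelow-mono entries le)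

  standardise-mono-< : ∀ i j r l → W i j < W r l → standardise i j < standardise r l
  standardise-mono-< i j _ _ lt = s≤s (countBelow-mono-< entries (combine i j)
    (≤-reflexive (sym (entries-combine i j))) (≤-<-trans (≤-reflexive (entries-combine i j)) lt))

  standardise-reflects-< : ∀ i j r l → standardise i j < standardise r l → W i j < W r l
  standardise-reflects-< i j r l lt = ≰⇒> (λ le → <⇒≱ lt (standardise-mono-≤ r l i j le))

  standardise-reflects-≤ : ∀ i j r l → standardise i j ≤ standardise r l → W i j ≤ W r l
  standardise-reflects-≤ i j r l le = ≮⇒≥ (λ lt → <⇒≱ (standardise-mono-< r l i j lt) le)

  standardise-injective : InjectiveFilling W → InjectiveFilling standardise
  standardise-injective W-inj i j r l eq = W-inj i j r l (≤-antisym
    (standardise-reflects-≤ i j r l (≤-reflexive eq))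
    (standardise-reflects-≤ r l i j (≤-reflexive (sym eq))))

  standardise-range : ∀ i j → 1 ≤ standardise i j × standardise i j ≤ k * n
  standardise-range i j = s≤s z≤n , subst (countBelow entries (W i j) <_) (*-comm n k)
    (countBelow<length entries (combine i j) (≤-reflexive (sym (entries-combine i j))))

module _ {n m : ℕ} (κ : Fin n → Fin m) (b : Fin n → ℕ) where

  lowerRows : Fin n → List (Fin n)
  lowerRows i = filter (λ r → κ r Fin.≤? κ i) (allFin n)

  peak : Fin n → Fin n
  peak i = argmax b i (lowerRows i)

  peak-below : ∀ i → κ (peak i) Fin.≤ κ i
  peak-below i = argmax-all b {P = λ s → κ s Fin.≤ κ i} ≤-refl
    (all-filter (λ r → κ r Fin.≤? κ i) (allFin n))

  peak-maximal : ∀ {r i} → κ r Fin.≤ κ i → b r ≤ b (peak i)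
  peak-maximal {r} {i} κr≤κi = v≤f[argmax]⁺ i (lowerRows i)
    (inj₂ (lose (∈-filter⁺ (λ r → κ r Fin.≤? κ i) (∈-allFin r) κr≤κi) ≤-refl))

  peak-mono : ∀ {i i′} → κ i Fin.≤ κ i′ → b (peak i) ≤ b (peak i′)
  peak-mono {i} κi≤κi′ = peak-maximal (≤-trans (peak-below i) κi≤κi′)

⟨$⟩ʳ-injective : ∀ {n} (π : Permutation′ n) {x y} → π ⟨$⟩ʳ x ≡ π ⟨$⟩ʳ y → x ≡ y
⟨$⟩ʳ-injective π = Injection.injective (↔⇒↣ π)

allowable-dominance : ∀ {n} (π γ : Permutation′ n) → AllowablePair π γ →
  ∀ {i r s} → i Fin.< r → π ⟨$⟩ʳ s Fin.≤ π ⟨$⟩ʳ i → γ ⟨$⟩ʳ r Fin.≤ γ ⟨$⟩ʳ s →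
  γ ⟨$⟩ʳ r Fin.< γ ⟨$⟩ʳ i
allowable-dominance π γ (inversions , no-pattern) {i} {r} {s} i<r πs≤πi γr≤γs
  with Fin.<-cmp s i
... | tri≈ _ refl _ = Fin.≤∧≢⇒< γr≤γs (Fin.<⇒≢ i<r ∘ sym ∘ ⟨$⟩ʳ-injective γ)
... | tri> _ _ i<s  = ≤-<-trans γr≤γs
  (inversions i s i<s (Fin.≤∧≢⇒< πs≤πi (Fin.<⇒≢ i<s ∘ sym ∘ ⟨$⟩ʳ-injective π)))
... | tri< s<i _ _ with Fin.<-cmp (π ⟨$⟩ʳ i) (π ⟨$⟩ʳ r)
...   | tri> _ _ πr<πi = inversions i r i<r πr<πi
...   | tri≈ _ πi≡πr _ = contradiction (⟨$⟩ʳ-injective π πi≡πr) (Fin.<⇒≢ i<r)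
...   | tri< πi<πr _ _ with Fin.<-cmp (γ ⟨$⟩ʳ i) (γ ⟨$⟩ʳ r)
...     | tri> _ _ γr<γi = γr<γi
...     | tri≈ _ γi≡γr _ = contradiction (⟨$⟩ʳ-injective γ γi≡γr) (Fin.<⇒≢ i<r)
...     | tri< γi<γr _ _ = contradiction (γi<γr , γr<γs)
  (no-pattern s i r s<i i<r (Fin.≤∧≢⇒< πs≤πi (Fin.<⇒≢ s<i ∘ ⟨$⟩ʳ-injective π)) πi<πr)
  where
  γr<γs : γ ⟨$⟩ʳ r Fin.< γ ⟨$⟩ʳ s
  γr<γs = Fin.≤∧≢⇒< γr≤γs (Fin.<⇒≢ (<-trans s<i i<r) ∘ sym ∘ ⟨$⟩ʳ-injective γ)

decreasing-from-steps : ∀ {k} (f : Fin k → ℕ) →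
  (∀ j j′ → toℕ j′ ≡ suc (toℕ j) → f j′ < f j) → ∀ j j′ → j Fin.< j′ → f j′ < f j
decreasing-from-steps f step zero (suc zero) _ = step zero (suc zero) refl
decreasing-from-steps f step zero (suc (suc j′)) _ = <-trans
  (decreasing-from-steps (f ∘ suc) (λ j j′ eq → step (suc j) (suc j′) (cong suc eq))
    zero (suc j′) z<s)
  (step zero (suc zero) refl)
decreasing-from-steps f step (suc j) (suc j′) (s≤s j<j′) =
  decreasing-from-steps (f ∘ suc) (λ j j′ eq → step (suc j) (suc j′) (cong suc eq)) j j′ j<j′

digit : ∀ {n} → Permutation′ n → Fin n → ℕ
digit π i = suc (toℕ (π ⟨$⟩ʳ i))

column     : ∀ {n k} → (Fin k → Permutation′ n) → Fin k → Fin n → ℕ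
height     : ∀ {n k} → (Fin k → Permutation′ n) → Fin k → Fin n → ℕ
nextColumn : ∀ {n k} → (Fin (suc k) → Permutation′ n) → Fin n → ℕ

column {n} σ j i = suc n * height σ j i + digit (σ j) i

height σ zero    i = nextColumn σ (peak (σ zero ⟨$⟩ʳ_) (nextColumn σ) i)
height σ (suc j) i = height (σ ∘ suc) j i

nextColumn {k = zero}  σ i = 0
nextColumn {k = suc k} σ i = column (σ ∘ suc) zero i

height-step : ∀ {n k} (σ : Fin k → Permutation′ n) j j′ i → toℕ j′ ≡ suc (toℕ j) →
              height σ j i ≡ column σ j′ (peak (σ j ⟨$⟩ʳ_) (column σ j′) i)
height-step σ zero    (suc zero) i refl = refl
height-step σ (suc j) (suc j′)   i eq   = height-step (σ ∘ suc) j j′ i (suc-injective eq)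

height-mono : ∀ {n k} (σ : Fin k → Permutation′ n) j {x y} →
              σ j ⟨$⟩ʳ x Fin.≤ σ j ⟨$⟩ʳ y → height σ j x ≤ height σ j y
height-mono σ zero    le = peak-mono (σ zero ⟨$⟩ʳ_) (nextColumn σ) le
height-mono σ (suc j) le = height-mono (σ ∘ suc) j le

module _ {n k} (σ : Fin k → Permutation′ n) (j : Fin k) where

  column-mono-≤ : ∀ {x y} → σ j ⟨$⟩ʳ x Fin.≤ σ j ⟨$⟩ʳ y → column σ j x ≤ column σ j y
  column-mono-≤ le = +-mono-≤ (*-monoʳ-≤ (suc n) (height-mono σ j le)) (s≤s le)

  column-mono-< : ∀ {x y} → σ j ⟨$⟩ʳ x Fin.< σ j ⟨$⟩ʳ y → column σ j x < column σ j y
  column-mono-< lt = +-mono-≤-< (*-monoʳ-≤ (suc n) (height-mono σ j (<⇒≤ lt))) (s≤s lt)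

  column-reflects-< : ∀ {x y} → column σ j x < column σ j y → σ j ⟨$⟩ʳ x Fin.< σ j ⟨$⟩ʳ y
  column-reflects-< lt = ≰⇒> (λ le → <⇒≱ lt (column-mono-≤ le))

  column-reflects-≤ : ∀ {x y} → column σ j x ≤ column σ j y → σ j ⟨$⟩ʳ x Fin.≤ σ j ⟨$⟩ʳ y
  column-reflects-≤ le = ≮⇒≥ (λ lt → <⇒≱ (column-mono-< lt) le)

  column-injective : ∀ {x y} → column σ j x ≡ column σ j y → x ≡ y
  column-injective eq = ⟨$⟩ʳ-injective (σ j) (Fin.≤-antisym
    (column-reflects-≤ (≤-reflexive eq)) (column-reflects-≤ (≤-reflexive (sym eq))))

preTableau : ∀ {n k} → (Fin k → Permutation′ n) → Filling n k
preTableau {n} σ i j = suc n ^ toℕ j * column σ j i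

module _ {n k} (σ : Fin k → Permutation′ n) where

  private
    N : ℕ
    N = suc n

    N^≢0 : ∀ a → NonZero (N ^ a)
    N^≢0 a = m^n≢0 N a

    digit<N : ∀ π i → digit {n} π i < N
    digit<N π i = s≤s (Fin.toℕ<n (π ⟨$⟩ʳ i))

  preTableau-mono-< : ∀ j x y → σ j ⟨$⟩ʳ x Fin.< σ j ⟨$⟩ʳ y → preTableau σ x j < preTableau σ y j
  preTableau-mono-< j _ _ lt = *-monoʳ-< (N ^ toℕ j) {{N^≢0 (toℕ j)}} (column-mono-< σ j lt)

  preTableau-reflects-< : ∀ j x y → preTableau σ x j < preTableau σ y j →
                          σ j ⟨$⟩ʳ x Fin.< σ j ⟨$⟩ʳ y
  preTableau-reflects-< j _ _ lt = column-reflects-< σ j (*-cancelˡ-< (N ^ toℕ j) _ _ lt)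

  preTableau-next : ∀ {j j′ : Fin k} r → toℕ j′ ≡ suc (toℕ j) →
                    preTableau σ r j′ ≡ N ^ toℕ j * (N * column σ j′ r)
  preTableau-next {j} {j′} r eq =
    trans (cong (λ a → N ^ a * column σ j′ r) eq) (^-suc-* N (toℕ j) (column σ j′ r))

  preTableau-next-< : ∀ {j j′ : Fin k} {i r} → toℕ j′ ≡ suc (toℕ j) →
                      column σ j′ r ≤ height σ j i → preTableau σ r j′ < preTableau σ i j
  preTableau-next-< {j} {j′} {i} {r} eq le =
    subst (_< preTableau σ i j) (sym (preTableau-next r eq))
      (*-monoʳ-< (N ^ toℕ j) {{N^≢0 (toℕ j)}} (v≤m⇒b*v<b*m+d N z<s le))

  preTableau-next-≤ : ∀ {j j′ : Fin k} {i r} → toℕ j′ ≡ suc (toℕ j) →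
                      preTableau σ r j′ ≤ preTableau σ i j → column σ j′ r ≤ height σ j i
  preTableau-next-≤ {j} {j′} {i} {r} eq le = b*v≤b*m+d⇒v≤m N (digit<N (σ j) i)
    (*-cancelˡ-≤ (N ^ toℕ j) {{N^≢0 (toℕ j)}}
      (subst (_≤ preTableau σ i j) (preTableau-next r eq) le))

  preTableau-row-step : ∀ i j j′ → toℕ j′ ≡ suc (toℕ j) → preTableau σ i j′ < preTableau σ i j
  preTableau-row-step i j j′ eq = preTableau-next-< eq (subst (column σ j′ i ≤_)
    (sym (height-step σ j j′ i eq)) (peak-maximal (σ j ⟨$⟩ʳ_) (column σ j′) ≤-refl))

  preTableau-distinct-columns : ∀ {i r} {j l : Fin k} → toℕ j < toℕ l →
                                preTableau σ i j ≢ preTableau σ r l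
  preTableau-distinct-columns {i} {r} {j} {l} j<l eq with ^-*-multiple N (column σ l r) j<l
  ... | v , eq′ = b*v≢b*m+d N z<s (digit<N (σ j) i)
    (sym (*-cancelˡ-≡ _ _ (N ^ toℕ j) {{N^≢0 (toℕ j)}} (trans eq eq′)))

  preTableau-injective : InjectiveFilling (preTableau σ)
  preTableau-injective i j r l eq with Fin.<-cmp j l
  ... | tri< j<l _ _ = contradiction eq (preTableau-distinct-columns j<l)
  ... | tri> _ _ l<j = contradiction (sym eq) (preTableau-distinct-columns l<j)
  ... | tri≈ _ refl _ =
    column-injective σ j (*-cancelˡ-≡ _ _ (N ^ toℕ j) {{N^≢0 (toℕ j)}} eq) , refl

  preTableau-triple : ∀ {i r} {j j′ : Fin k} → AllowablePair (σ j) (σ j′) →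
                      toℕ j′ ≡ suc (toℕ j) → i Fin.< r →
                      preTableau σ r j′ ≤ preTableau σ i j → preTableau σ r j′ < preTableau σ i j′
  preTableau-triple {i} {r} {j} {j′} allowable eq i<r le = preTableau-mono-< j′ r i
    (allowable-dominance (σ j) (σ j′) allowable {i} {r} {s} i<r
      (peak-below (σ j ⟨$⟩ʳ_) (column σ j′) i) r-below-s)
    where
    s : Fin n
    s = peak (σ j ⟨$⟩ʳ_) (column σ j′) i

    r-below-s : σ j′ ⟨$⟩ʳ r Fin.≤ σ j′ ⟨$⟩ʳ s
    r-below-s = column-reflects-≤ σ j′
      (subst (column σ j′ r ≤_) (height-step σ j j′ i eq) (preTableau-next-≤ eq le))

allowableSeq-step : ∀ {n k} {σ : Fin k → Permutation′ n} → AllowableSeq σ →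
                    ∀ j j′ → toℕ j′ ≡ suc (toℕ j) → AllowablePair (σ j) (σ j′)
allowableSeq-step {k = suc k} {σ} allowable j (suc j′) eq =
  subst (λ i → AllowablePair (σ i) (σ (suc j′))) inject₁j′≡j (allowable j′)
  where
  inject₁j′≡j : inject₁ j′ ≡ j
  inject₁j′≡j = Fin.toℕ-injective (trans (Fin.toℕ-inject₁ j′) (suc-injective eq))

theorem5p6 : (n k : ℕ) → k ≥ 2 → (σ : Fin k → Permutation′ n) → AllowableSeq σ →
    Σ (Filling n k) (λ τ → IsSPCT τ × (∀ (j : Fin k) → StEq τ j (σ j)))
theorem5p6 n k _ σ allowable = standardise W , isSPCT , standardisation
  where
  W : Filling n k
  W = preTableau σ

  isSPCT : IsSPCT (standardise W)
  isSPCT = record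
    { distinct = standardise-injective W (preTableau-injective σ)
    ; range    = standardise-range W
    ; rowsDec  = λ i j j′ j<j′ → standardise-mono-< W i j′ i j
        (decreasing-from-steps (W i) (preTableau-row-step σ i) j j′ j<j′)
    ; triple   = λ i r j j′ eq i<r le → standardise-mono-< W r j′ i j′
        (preTableau-triple σ (allowableSeq-step allowable j j′ eq) eq i<r
          (standardise-reflects-≤ W r j′ i j le))
    }

  standardisation : ∀ j → StEq (standardise W) j (σ j)
  standardisation j i r = mk⇔
    (λ lt → standardise-mono-< W r j i j (preTableau-mono-< σ j r i lt))
    (λ lt → preTableau-reflects-< σ j r i (standardise-reflects-< W r j i j lt))
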